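{- Let $\mathbf{v}=(v_1,\dots,v_m)$ and $\mathbf{k}=(k_1,\dots,k_m)$ be $m$-tuples of positive integers with $\mathbf{v}\ge\mathbf{k}$, and let $\mathbf{r}=(r_1,\dots,r_m)$ be a tuple of integers with $0\le r_i\le k_i-2$ for all $i$. Then \[ C(\mathbf{v},\mathbf{k},2)\le C(\mathbf{v}-\mathbf{r},\mathbf{k}-\mathbf{r},2). \]
   Context: $\mathbf{v}\ge\mathbf{k}$ means componentwise; vector subtraction is componentwise. Generalized covering designs: for $m$-tuples of positive integers $\mathbf{v}$, $\mathbf{k}$ with $k_i\le v_i$ and an integer $t$ with $1\le t\le \sum_i k_i$, let $X_1,\dots,X_m$ be pairwise disjoint sets with $|X_i|=v_i$. A block is an $m$-tuple $(B_1,\dots,B_m)$ with $B_i\subseteq X_i$, $|B_i|=k_i$. An $m$-tuple of sets $(T_1,\dots,T_m)$ is $(\mathbf{v},\mathbf{k},t)$-admissible if $T_i\subseteq X_i$, $|T_i|\le k_i$ and $\sum_i|T_i|=t$; it is contained in a block if $T_i\subseteq B_i$ for all $i$. A ${\rm GC}(\mathbf{v},\mathbf{k},t)$ is a family of blocks (repetitions allowed) such that every admissible tuple is contained in at least one block, and $C(\mathbf{v},\mathbf{k},t)$ is the minimum number of blocks of a ${\rm GC}(\mathbf{v},\mathbf{k},t)$. -}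

module Defs where

open import Data.Nat using (ℕ; zero; suc; _+_; _≤_)
open import Data.Fin using (Fin)
open import Data.Fin.Subset using (Subset; _⊆_; ∣_∣)
open import Data.List using (List; length)
open import Data.List.Relation.Unary.All using (All)
open import Data.List.Relation.Unary.Any using (Any)
open import Data.Product using (Σ; _×_)
open import Relation.Binary.PropositionalEquality using (_≡_)

sumFin : (m : ℕ) → (Fin m → ℕ) → ℕ
sumFin zero    f = 0
sumFin (suc m) f = f Fin.zero + sumFin m (λ i → f (Fin.suc i))

-- The point sets are X_i = Fin (v i) (pairwise disjoint by being indexed by i).
-- An m-tuple of subsets (T_1,...,T_m) with T_i ⊆ X_i.
Tuple : (m : ℕ) → (Fin m → ℕ) → Set
Tuple m v = (i : Fin m) → Subset (v i)

IsBlock : {m : ℕ} (v k : Fin m → ℕ) → Tuple m v → Set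
IsBlock {m} v k B = (i : Fin m) → ∣ B i ∣ ≡ k i

Admissible : {m : ℕ} (v k : Fin m → ℕ) (t : ℕ) → Tuple m v → Set
Admissible {m} v k t T = ((i : Fin m) → ∣ T i ∣ ≤ k i) × (sumFin m (λ i → ∣ T i ∣) ≡ t)

ContainedIn : {m : ℕ} {v : Fin m → ℕ} → Tuple m v → Tuple m v → Set
ContainedIn {m} T B = (i : Fin m) → T i ⊆ B i

-- A GC(v,k,t): a family (list, repetitions allowed) of blocks covering every
-- admissible tuple.
IsGC : {m : ℕ} (v k : Fin m → ℕ) (t : ℕ) → List (Tuple m v) → Set
IsGC v k t F =
  All (IsBlock v k) F ×
  ((T : Tuple _ v) → Admissible v k t T → Any (ContainedIn T) F)

IsCoveringNumber : {m : ℕ} (v k : Fin m → ℕ) (t : ℕ) → ℕ → Set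
IsCoveringNumber {m} v k t n =
  Σ (List (Tuple m v)) (λ F → IsGC v k t F × length F ≡ n) ×
  ((F : List (Tuple m v)) → IsGC v k t F → n ≤ length F)

-- Fix a GC(v − r, k − r, 2) on point sets X′ᵢ ⊆ Xᵢ with |Xᵢ ∖ X′ᵢ| = rᵢ and add Xᵢ ∖ X′ᵢ to the
-- i-th part of every block; this gives blocks for (v, k) and keeps the number of blocks. An
-- admissible pair T has |Tᵢ| ≤ 2 ≤ kᵢ − rᵢ, so its trace Tᵢ ∩ X′ᵢ can be enlarged to a set of
-- size |Tᵢ| inside X′ᵢ; the resulting admissible tuple lies in some old block, whose extension
-- then contains T. More generally C(v, k, t) ≤ C(v − r, k − r, t) whenever t ≤ kᵢ − rᵢ.
module Submission where

open import Defs
open import Data.Nat using (ℕ; zero; suc; _≤_; _+_; _∸_; z≤n; s≤s)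
open import Data.Nat.Properties
open import Data.Fin using (Fin)
open import Data.Fin.Subset using (Subset; _⊆_; ∣_∣; ⊤; inside; outside)
open import Data.Fin.Subset.Properties using (∣⊤∣≡n; ⊆⊤; ⊆-refl; ⊆-trans; s⊆s; out⊆; drop-∷-⊆)
open import Data.Vec using ([]; _∷_; _++_; here)
open import Data.List using (map)
open import Data.List.Properties using (length-map)
open import Data.List.Relation.Unary.All as All using (All)
import Data.List.Relation.Unary.All.Properties as All
open import Data.List.Relation.Unary.Any as Any using (Any)
import Data.List.Relation.Unary.Any.Properties as Any
open import Data.Product using (∃-syntax; _×_; _,_; proj₁; proj₂)
open import Relation.Binary.PropositionalEquality using (_≡_; refl; sym; trans; cong; cong₂; subst; module ≡-Reasoning)
open import Relation.Nullary using (yes; no)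

superset-of-size : ∀ {n} (p : Subset n) {c} → ∣ p ∣ ≤ c → c ≤ n → ∃[ q ] p ⊆ q × ∣ q ∣ ≡ c
superset-of-size []           z≤n       z≤n = [] , ⊆-refl , refl
superset-of-size (inside ∷ p) (s≤s p≤c) (s≤s c≤n) =
  let q , p⊆q , ∣q∣≡c = superset-of-size p p≤c c≤n in inside ∷ q , s⊆s p⊆q , cong suc ∣q∣≡c
superset-of-size {suc n} (outside ∷ p) {c} p≤c c≤1+n with c ≤? n
... | yes c≤n = let q , p⊆q , ∣q∣≡c = superset-of-size p p≤c c≤n in outside ∷ q , out⊆ p⊆q , ∣q∣≡c
... | no  c≰n = ⊤ , ⊆⊤ , trans (∣⊤∣≡n (suc n)) (≤-antisym (≰⇒> c≰n) c≤1+n)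

prefix : ∀ n {ρ} → Subset (n + ρ) → Subset n
prefix zero    _       = []
prefix (suc n) (s ∷ p) = s ∷ prefix n p

∣prefix∣≤ : ∀ n {ρ} (p : Subset (n + ρ)) → ∣ prefix n p ∣ ≤ ∣ p ∣
∣prefix∣≤ zero    p            = z≤n
∣prefix∣≤ (suc n) (inside ∷ p)  = s≤s (∣prefix∣≤ n p)
∣prefix∣≤ (suc n) (outside ∷ p) = ∣prefix∣≤ n p

∣p++⊤∣ : ∀ {n} ρ (p : Subset n) → ∣ p ++ ⊤ {ρ} ∣ ≡ ∣ p ∣ + ρ
∣p++⊤∣ ρ []            = ∣⊤∣≡n ρ
∣p++⊤∣ ρ (inside ∷ p)  = cong suc (∣p++⊤∣ ρ p)
∣p++⊤∣ ρ (outside ∷ p) = ∣p++⊤∣ ρ p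

prefix⊆⇒⊆++⊤ : ∀ n {ρ} (p : Subset (n + ρ)) {q : Subset n} → prefix n p ⊆ q → p ⊆ q ++ ⊤
prefix⊆⇒⊆++⊤ zero    p             {[]}          _ = ⊆⊤
prefix⊆⇒⊆++⊤ (suc n) (outside ∷ p) {_ ∷ q}       h = out⊆ (prefix⊆⇒⊆++⊤ n p (drop-∷-⊆ h))
prefix⊆⇒⊆++⊤ (suc n) (inside ∷ p)  {inside ∷ q}  h = s⊆s (prefix⊆⇒⊆++⊤ n p (drop-∷-⊆ h))
prefix⊆⇒⊆++⊤ (suc n) (inside ∷ p)  {outside ∷ q} h with h here
... | ()

-- A point set of size n containing one of size n′ together with ρ further points.
record Extension (n′ ρ n : ℕ) : Set where
  field
    restrict           : Subset n → Subset n′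
    extend             : Subset n′ → Subset n
    ∣restrict∣≤        : ∀ p → ∣ restrict p ∣ ≤ ∣ p ∣
    ∣extend∣≡          : ∀ q → ∣ extend q ∣ ≡ ∣ q ∣ + ρ
    restrict⊆⇒⊆extend : ∀ p {q} → restrict p ⊆ q → p ⊆ extend q

extension : ∀ {n} n′ ρ → n ≡ n′ + ρ → Extension n′ ρ n
extension n′ ρ refl = record
  { restrict           = prefix n′
  ; extend             = _++ ⊤
  ; ∣restrict∣≤        = ∣prefix∣≤ n′
  ; ∣extend∣≡          = ∣p++⊤∣ ρ
  ; restrict⊆⇒⊆extend = prefix⊆⇒⊆++⊤ n′
  }

sumFin-cong : ∀ m {f g : Fin m → ℕ} → (∀ i → f i ≡ g i) → sumFin m f ≡ sumFin m g
sumFin-cong zero    f≡g = refl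
sumFin-cong (suc m) f≡g = cong₂ _+_ (f≡g Fin.zero) (sumFin-cong m (λ i → f≡g (Fin.suc i)))

≤-sumFin : ∀ m (f : Fin m → ℕ) i → f i ≤ sumFin m f
≤-sumFin (suc m) f Fin.zero    = m≤m+n _ _
≤-sumFin (suc m) f (Fin.suc i) = ≤-trans (≤-sumFin m _ i) (m≤n+m _ _)

module _ {m t : ℕ} {v v′ k k′ r : Fin m → ℕ}
         (X : (i : Fin m) → Extension (v′ i) (r i) (v i))
         (k≡k′+r : ∀ i → k i ≡ k′ i + r i)
         (t≤k′ : ∀ i → t ≤ k′ i)
         (k′≤v′ : ∀ i → k′ i ≤ v′ i)
  where
  open Extension

  extendTuple : Tuple m v′ → Tuple m v
  extendTuple B i = extend (X i) (B i)

  extendTuple-isBlock : ∀ {B} → IsBlock v′ k′ B → IsBlock v k (extendTuple B)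
  extendTuple-isBlock {B} B-block i = begin
    ∣ extend (X i) (B i) ∣  ≡⟨ ∣extend∣≡ (X i) (B i) ⟩
    ∣ B i ∣ + r i          ≡⟨ cong (_+ r i) (B-block i) ⟩
    k′ i + r i             ≡⟨ sym (k≡k′+r i) ⟩
    k i                    ∎
    where open ≡-Reasoning

  -- Each part is enlarged back to its original size, so the sum is still t.
  restriction-admissible : ∀ {T} → Admissible v k t T →
    ∃[ T′ ] Admissible v′ k′ t T′ × (∀ i → restrict (X i) (T i) ⊆ T′ i)
  restriction-admissible {T} (_ , ∑∣T∣≡t) =
      (λ i → proj₁ (padded i))
    , ((λ i → subst (_≤ k′ i) (sym (proj₂ (proj₂ (padded i)))) (≤-trans (∣T∣≤t i) (t≤k′ i)))
      , trans (sumFin-cong m (λ i → proj₂ (proj₂ (padded i)))) ∑∣T∣≡t)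
    , (λ i → proj₁ (proj₂ (padded i)))
    where
    ∣T∣≤t : ∀ i → ∣ T i ∣ ≤ t
    ∣T∣≤t i = subst (∣ T i ∣ ≤_) ∑∣T∣≡t (≤-sumFin m (λ j → ∣ T j ∣) i)

    padded : ∀ i → ∃[ q ] restrict (X i) (T i) ⊆ q × ∣ q ∣ ≡ ∣ T i ∣
    padded i = superset-of-size (restrict (X i) (T i)) (∣restrict∣≤ (X i) (T i))
                 (≤-trans (∣T∣≤t i) (≤-trans (t≤k′ i) (k′≤v′ i)))

  extend-isGC : ∀ {F} → IsGC v′ k′ t F → IsGC v k t (map extendTuple F)
  extend-isGC (blocks , covers) =
      All.map⁺ (All.map extendTuple-isBlock blocks)
    , λ T T-adm →
        let T′ , T′-adm , T⊆T′ = restriction-admissible T-adm in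
        Any.map⁺ (Any.map (λ T′⊆B i {_} → restrict⊆⇒⊆extend (X i) (T i) (⊆-trans (T⊆T′ i) (T′⊆B i)))
                          (covers T′ T′-adm))

proposition3p23 : (m : ℕ) (v k r : Fin m → ℕ) →
    ((i : Fin m) → 1 ≤ k i) →
    ((i : Fin m) → k i ≤ v i) →
    ((i : Fin m) → r i + 2 ≤ k i) →
    (a b : ℕ) →
    IsCoveringNumber v k 2 a →
    IsCoveringNumber (λ i → v i ∸ r i) (λ i → k i ∸ r i) 2 b →
    a ≤ b
proposition3p23 m v k r _ k≤v r+2≤k a b (_ , a-minimal) ((F , F-isGC , refl) , _) =
  subst (a ≤_) (length-map _ F) (a-minimal _ (extend-isGC X k≡k∸r+r 2≤k∸r k∸r≤v∸r F-isGC))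
  where
  r≤k : ∀ i → r i ≤ k i
  r≤k i = m+n≤o⇒m≤o (r i) (r+2≤k i)

  X : ∀ i → Extension (v i ∸ r i) (r i) (v i)
  X i = extension _ _ (sym (m∸n+n≡m (≤-trans (r≤k i) (k≤v i))))

  k≡k∸r+r : ∀ i → k i ≡ k i ∸ r i + r i
  k≡k∸r+r i = sym (m∸n+n≡m (r≤k i))

  2≤k∸r : ∀ i → 2 ≤ k i ∸ r i
  2≤k∸r i = m+n≤o⇒m≤o∸n 2 (subst (_≤ k i) (+-comm (r i) 2) (r+2≤k i))

  k∸r≤v∸r : ∀ i → k i ∸ r i ≤ v i ∸ r i
  k∸r≤v∸r i = ∸-monoˡ-≤ (r i) (k≤v i)
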